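{- Let $n\ge 34$ be an even integer and let $D_n=2\lceil n/4\rceil-1$. There exists a graph of order $n$ in which every vertex has degree $D_n$ or $D_n+1$, and whose maximum number of pairwise edge-disjoint perfect matchings is exactly $\lceil n/4\rceil$.
   Context: All graphs are finite, simple, and undirected. -}

module Defs where

open import Data.Nat using (ℕ; _+_; _≤_)
open import Data.Nat.DivMod using (_/_)
open import Data.Bool using (Bool; true; false; T; _∧_)
open import Data.Bool.Properties using (T?)
open import Data.Fin using (Fin)
open import Data.List using (List; length; filter)
open import Data.List using (allFin)
open import Data.Product using (Σ; _×_; ∃-syntax)
open import Data.Empty using (⊥)
open import Relation.Binary.PropositionalEquality using (_≡_; _≢_)

⌈_/4⌉ : ℕ → ℕ
⌈ n /4⌉ = (n + 3) / 4

record Graph (n : ℕ) : Set where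
  field
    adj    : Fin n → Fin n → Bool
    sym    : ∀ u v → adj u v ≡ adj v u
    irrefl : ∀ v → adj v v ≡ false
open Graph public

degreeOf : {n : ℕ} → (Fin n → Fin n → Bool) → Fin n → ℕ
degreeOf {n} a v = length (filter (λ u → T? (a v u)) (allFin n))

degree : {n : ℕ} → Graph n → Fin n → ℕ
degree G v = degreeOf (adj G) v

record PerfectMatching {n : ℕ} (G : Graph n) : Set where
  field
    medge   : Fin n → Fin n → Bool
    msym    : ∀ u v → medge u v ≡ medge v u
    msub    : ∀ u v → T (medge u v) → T (adj G u v)
    mperfect : ∀ v → degreeOf medge v ≡ 1
open PerfectMatching public

EdgeDisjoint : {n : ℕ} {G : Graph n} → PerfectMatching G → PerfectMatching G → Set
EdgeDisjoint M N = ∀ u v → T (medge M u v) → T (medge N u v) → ⊥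

DisjointPMFamily : {n : ℕ} → Graph n → ℕ → Set
DisjointPMFamily G k =
  Σ (Fin k → PerfectMatching G) λ F → ∀ i j → i ≢ j → EdgeDisjoint (F i) (F j)

MaxDisjointPM : {n : ℕ} → Graph n → ℕ → Set
MaxDisjointPM G k = DisjointPMFamily G k × (∀ m → DisjointPMFamily G m → m ≤ k)

module Submission where

-- Write n = 2m + 2 with m = 2K + e, e ∈ {0, 1}, so that k = K + 1. Split the
-- vertices [0, n) into A = [0, m + 2) and an independent set B = [m + 2, n) of size m.
-- Inside A the first 2k vertices form the k pairs {2t, 2t + 1}; A and B are completely
-- joined, except that for odd m the edges {x, m + 2 + x}, x < m, are left out.
--
-- Upper bound: |A| > |B| and B is independent, so by pigeonhole every perfect matching
-- contains an edge inside A, i.e. one of the k pairs, and disjoint matchings use distinct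
-- pairs. Lower bound: the i-th matching takes pair i and joins the remaining m vertices
-- of A to B by deleting pair i and rotating by 3 + i modulo m. It is given by an
-- involution of [0, n), and distinct i move every vertex of A by distinct amounts.

open import Defs
open import Data.Nat using (ℕ; _≤_; _+_; _∸_; _*_)
open import Data.Nat.Divisibility using (_∣_)
open import Data.Fin using (Fin)
open import Data.Sum using (_⊎_)
open import Data.Product using (Σ; _×_)
open import Relation.Binary.PropositionalEquality using (_≡_)

open import Data.Nat using (zero; suc; _<_; z≤n; s≤s; z<s; s≤s⁻¹; _≟_; _<?_; _≤?_)
open import Data.Nat.Properties
open import Data.Nat.Divisibility using (divides)
open import Data.Nat.DivMod using (_/_; +-distrib-/-∣ˡ; m*n/n≡m; m<n⇒m/n≡0)
open import Data.Nat.Tactic.RingSolver using (solve-∀)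
open import Data.Bool using (Bool; true; false; T; not; _∧_; if_then_else_)
open import Data.Bool.Properties using (T?; T-∧; ∧-zeroʳ)
open import Data.Unit using (tt)
open import Data.Fin using (zero; suc; toℕ; fromℕ<; _↑ˡ_)
open import Data.Fin.Properties using (toℕ<n; toℕ-injective; toℕ-fromℕ<; toℕ-↑ˡ; ↑ˡ-injective; any?; pigeonhole)
  renaming (<⇒≢ to <⇒≢ᶠ)
open import Data.List using ([]; _∷_; length; filter; tabulate; allFin)
open import Data.List.Relation.Unary.Any using (here)
open import Data.List.Membership.Propositional.Properties using (∈-filter⁺; ∈-filter⁻; ∈-allFin)
open import Data.Product using (_,_; proj₁; proj₂; ∃; ∃₂)
open import Data.Sum using (inj₁; inj₂)
open import Data.Empty using (⊥-elim)
open import Function using (_∘_)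
open import Function.Bundles using (module Equivalence)
open import Relation.Binary.PropositionalEquality using (_≢_; refl; trans; cong; cong₂; subst; subst₂; module ≡-Reasoning)
  renaming (sym to ≡-sym)
open import Relation.Nullary using (Dec; yes; no; ¬_)
open import Relation.Nullary.Decidable using (⌊_⌋; toWitness; fromWitness)

yes⇒true : ∀ {P : Set} (d : Dec P) → P → ⌊ d ⌋ ≡ true
yes⇒true (yes _) _  = refl
yes⇒true (no ¬p) p = ⊥-elim (¬p p)

no⇒false : ∀ {P : Set} (d : Dec P) → ¬ P → ⌊ d ⌋ ≡ false
no⇒false (yes p) ¬p = ⊥-elim (¬p p)
no⇒false (no _)  _  = refl

count : (ℕ → Bool) → ℕ → ℕ → ℕ
count P s zero    = 0
count P s (suc l) = (if P s then 1 else 0) + count P (suc s) l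

count-tabulate : ∀ {M} N s (g : Fin N → Fin M) (P : ℕ → Bool) →
  (∀ u → toℕ (g u) ≡ s + toℕ u) →
  length (filter (λ w → T? (P (toℕ w))) (tabulate g)) ≡ count P s N
count-tabulate zero    s g P g≗ = refl
count-tabulate (suc N) s g P g≗ rewrite g≗ zero | +-identityʳ s
  with P s | count-tabulate N (suc s) (g ∘ suc) P (λ u → trans (g≗ (suc u)) (+-suc s (toℕ u)))
... | true  | rest = cong suc rest
... | false | rest = rest

degreeOf-count : ∀ {N} (A : ℕ → ℕ → Bool) (v : Fin N) →
  degreeOf (λ u w → A (toℕ u) (toℕ w)) v ≡ count (A (toℕ v)) 0 N
degreeOf-count {N} A v = count-tabulate N 0 (λ u → u) (A (toℕ v)) (λ u → refl)

count-++ : ∀ P s p q → count P s (p + q) ≡ count P s p + count P (s + p) q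
count-++ P s zero    q = cong (λ t → count P t q) (≡-sym (+-identityʳ s))
count-++ P s (suc p) q = begin
  b + count P (suc s) (p + q)                     ≡⟨ cong (b +_) (count-++ P (suc s) p q) ⟩
  b + (count P (suc s) p + count P (suc s + p) q) ≡⟨ ≡-sym (+-assoc b _ _) ⟩
  b + count P (suc s) p + count P (suc s + p) q   ≡⟨ cong (λ t → b + count P (suc s) p + count P t q) (≡-sym (+-suc s p)) ⟩
  b + count P (suc s) p + count P (s + suc p) q   ∎
  where open ≡-Reasoning
        b = if P s then 1 else 0

count-cong : ∀ {P Q} s l → (∀ i → s ≤ i → i < s + l → P i ≡ Q i) → count P s l ≡ count Q s l
count-cong s zero    P≗Q = refl
count-cong s (suc l) P≗Q =
  cong₂ _+_ (cong (λ b → if b then 1 else 0) (P≗Q s ≤-refl (m<m+n s z<s)))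
            (count-cong (suc s) l (λ i s<i i< → P≗Q i (<⇒≤ s<i) (subst (i <_) (≡-sym (+-suc s l)) i<)))

count-none : ∀ {P} s l → (∀ i → s ≤ i → i < s + l → P i ≡ false) → count P s l ≡ 0
count-none s zero    none = refl
count-none s (suc l) none rewrite none s ≤-refl (m<m+n s z<s) =
  count-none (suc s) l (λ i s<i i< → none i (<⇒≤ s<i) (subst (i <_) (≡-sym (+-suc s l)) i<))

count-all : ∀ {P} s l → (∀ i → s ≤ i → i < s + l → P i ≡ true) → count P s l ≡ l
count-all s zero    all = refl
count-all s (suc l) all rewrite all s ≤-refl (m<m+n s z<s) =
  cong suc (count-all (suc s) l (λ i s<i i< → all i (<⇒≤ s<i) (subst (i <_) (≡-sym (+-suc s l)) i<)))

count-point : ∀ t s l → s ≤ t → t < s + l → count (λ i → ⌊ i ≟ t ⌋) s l ≡ 1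
count-point t s zero    s≤t t< = ⊥-elim (<-irrefl refl (≤-trans t< (subst (_≤ t) (≡-sym (+-identityʳ s)) s≤t)))
count-point t s (suc l) s≤t t< with s ≟ t
... | yes refl = cong suc (count-none (suc s) l later)
  where later : ∀ i → suc s ≤ i → i < suc s + l → ⌊ i ≟ s ⌋ ≡ false
        later i s<i _ with i ≟ s
        ... | yes refl = ⊥-elim (<-irrefl refl s<i)
        ... | no _     = refl
... | no s≢t   = count-point t (suc s) l (≤∧≢⇒< s≤t s≢t) (subst (t <_) (+-suc s l) t<)

count-complement : ∀ P s l → count (not ∘ P) s l + count P s l ≡ l
count-complement P s zero    = refl
count-complement P s (suc l) with P s
... | true  = trans (+-suc _ _) (cong suc (count-complement P (suc s) l))
... | false = cong suc (count-complement P (suc s) l)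

count-all-but : ∀ t s l → s ≤ t → t < s + l → count (λ i → not (⌊ i ≟ t ⌋)) s l + 1 ≡ l
count-all-but t s l s≤t t< =
  trans (cong (count (λ i → not (⌊ i ≟ t ⌋)) s l +_) (≡-sym (count-point t s l s≤t t<)))
        (count-complement (λ i → ⌊ i ≟ t ⌋) s l)

matching-partner : ∀ {N} {G : Graph N} (M : PerfectMatching G) (v : Fin N) → ∃ λ w → T (medge M v w)
matching-partner {N} M v
  with filter (λ u → T? (medge M v u)) (allFin N) | mperfect M v | (λ x → ∈-filter⁻ (λ u → T? (medge M v u)) {v = x} {xs = allFin N})
... | w ∷ [] | refl | member = w , proj₂ (member w (here refl))

partner : ∀ {N} {G : Graph N} → PerfectMatching G → Fin N → Fin N
partner M v = proj₁ (matching-partner M v)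

matching-partner-unique : ∀ {N} {G : Graph N} (M : PerfectMatching G) {v u w : Fin N} →
  T (medge M v u) → T (medge M v w) → u ≡ w
matching-partner-unique {N} M {v} {u} {w} vu vw
  with filter (λ x → T? (medge M v x)) (allFin N) | mperfect M v
     | ∈-filter⁺ (λ x → T? (medge M v x)) (∈-allFin u) vu | ∈-filter⁺ (λ x → T? (medge M v x)) (∈-allFin w) vw
... | _ ∷ [] | refl | here u≡x | here w≡x = trans u≡x (≡-sym w≡x)

-- Pigeonhole: if the first a of the a + b vertices outnumber the others (b < a),
-- a perfect matching cannot match all of them outside, so it has an edge inside them.
matching-inside-first-block : ∀ {a b} {G : Graph (a + b)} (M : PerfectMatching G) → b < a →
  ∃₂ λ u w → toℕ u < a × toℕ w < a × T (medge M u w)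
matching-inside-first-block {a} {b} M b<a with any? (λ z → toℕ (partner M (z ↑ˡ b)) <? a)
... | yes (z , inside) = z ↑ˡ b , partner M (z ↑ˡ b) ,
                         subst (_< a) (≡-sym (toℕ-↑ˡ z b)) (toℕ<n z) , inside , proj₂ (matching-partner M (z ↑ˡ b))
... | no allOutside = ⊥-elim (<⇒≢ᶠ z₁<z₂ (↑ˡ-injective b z₁ z₂ sameOrigin))
  where
  partnerOf : Fin a → Fin (a + b)
  partnerOf z = partner M (z ↑ˡ b)
  outside : ∀ z → a ≤ toℕ (partnerOf z)
  outside z = ≮⇒≥ (λ inside → allOutside (z , inside))
  indexInB : Fin a → Fin b
  indexInB z = fromℕ< (subst (toℕ (partnerOf z) ∸ a <_) (m+n∸m≡n a b) (∸-monoˡ-< (toℕ<n (partnerOf z)) (outside z)))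
  collision = pigeonhole b<a indexInB
  z₁ = proj₁ collision
  z₂ = proj₁ (proj₂ collision)
  z₁<z₂ = proj₁ (proj₂ (proj₂ collision))
  samePartner : partnerOf z₁ ≡ partnerOf z₂
  samePartner = toℕ-injective (begin
    toℕ (partnerOf z₁)                 ≡⟨ ≡-sym (m∸n+n≡m (outside z₁)) ⟩
    toℕ (partnerOf z₁) ∸ a + a         ≡⟨ cong (_+ a) (≡-sym (toℕ-fromℕ< _)) ⟩
    toℕ (indexInB z₁) + a                ≡⟨ cong (λ z → toℕ z + a) (proj₂ (proj₂ (proj₂ collision))) ⟩
    toℕ (indexInB z₂) + a                ≡⟨ cong (_+ a) (toℕ-fromℕ< _) ⟩
    toℕ (partnerOf z₂) ∸ a + a         ≡⟨ m∸n+n≡m (outside z₂) ⟩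
    toℕ (partnerOf z₂)                 ∎)
    where open ≡-Reasoning
  matchedBack : ∀ z → T (medge M (partnerOf z) (z ↑ˡ b))
  matchedBack z = subst T (msym M (z ↑ˡ b) (partnerOf z)) (proj₂ (matching-partner M (z ↑ˡ b)))
  sameOrigin : z₁ ↑ˡ b ≡ z₂ ↑ˡ b
  sameOrigin = matching-partner-unique M (matchedBack z₁) (subst (λ x → T (medge M x (z₂ ↑ˡ b))) (≡-sym samePartner) (matchedBack z₂))

-- If every perfect matching of G uses one of k given edges, then at most k perfect
-- matchings of G are pairwise edge-disjoint (two of them would share a given edge).
disjoint-family-bound : ∀ {N k} {G : Graph N} (x y : Fin k → Fin N) →
  (∀ (M : PerfectMatching G) → ∃ λ t → T (medge M (x t) (y t))) →
  ∀ m → DisjointPMFamily G m → m ≤ k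
disjoint-family-bound {k = k} x y forced m (F , disjoint) with m ≤? k
... | yes m≤k = m≤k
... | no m≰k = ⊥-elim (disjoint i j (<⇒≢ᶠ i<j) (x (usedBy i)) (y (usedBy i)) (proj₂ (forced (F i)))
                 (subst (λ t → T (medge (F j) (x t) (y t))) (≡-sym sameEdge) (proj₂ (forced (F j)))))
  where
  usedBy = λ i → proj₁ (forced (F i))
  collision = pigeonhole (≰⇒> m≰k) usedBy
  i = proj₁ collision
  j = proj₁ (proj₂ collision)
  i<j = proj₁ (proj₂ (proj₂ collision))
  sameEdge = proj₂ (proj₂ (proj₂ collision))

record MatchingInvolution {N : ℕ} (G : Graph N) : Set where
  field
    p          : ℕ → ℕ
    p-<        : ∀ u → u < N → p u < N
    involutive : ∀ u → u < N → p (p u) ≡ u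
    adjacent   : ∀ (u w : Fin N) → toℕ w ≡ p (toℕ u) → T (adj G u w)

involutionMatching : ∀ {N} {G : Graph N} → MatchingInvolution G → PerfectMatching G
involutionMatching {N} I = record
  { medge    = edge
  ; msym     = symmetric
  ; msub     = λ u w uw → adjacent u w (toWitness uw)
  ; mperfect = λ v → trans (degreeOf-count (λ x y → ⌊ y ≟ p x ⌋) v) (count-point _ 0 N z≤n (p-< _ (toℕ<n v)))
  }
  where
  open MatchingInvolution I
  edge : Fin N → Fin N → Bool
  edge u w = ⌊ toℕ w ≟ p (toℕ u) ⌋
  symmetric : ∀ u w → edge u w ≡ edge w u
  symmetric u w with toℕ w ≟ p (toℕ u) | toℕ u ≟ p (toℕ w)
  ... | yes _  | yes _  = refl
  ... | no _   | no _   = refl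
  ... | yes w≡ | no u≢ = ⊥-elim (u≢ (≡-sym (trans (cong p w≡) (involutive _ (toℕ<n u)))))
  ... | no w≢  | yes u≡ = ⊥-elim (w≢ (≡-sym (trans (cong p u≡) (involutive _ (toℕ<n w)))))

involutionMatchings-disjoint : ∀ {N} {G : Graph N} (I J : MatchingInvolution G) →
  (∀ u → u < N → MatchingInvolution.p I u ≢ MatchingInvolution.p J u) →
  EdgeDisjoint (involutionMatching I) (involutionMatching J)
involutionMatchings-disjoint I J differ u w uw uw′ =
  differ (toℕ u) (toℕ<n u) (trans (≡-sym (toWitness uw)) (toWitness uw′))

-- reduce m y is y mod m for y < 2m; rotate m s is the rotation x ↦ (x + s) mod m of [0, m).
reduce : ℕ → ℕ → ℕ
reduce m y = if ⌊ y <? m ⌋ then y else y ∸ m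

rotate : ℕ → ℕ → ℕ → ℕ
rotate m s x = reduce m (x + s)

reduce-< : ∀ m y → y < m + m → reduce m y < m
reduce-< m y y<2m with y <? m
... | yes y<m = y<m
... | no y≮m  = +-cancelʳ-< m _ _ (subst (_< m + m) (≡-sym (m∸n+n≡m (≮⇒≥ y≮m))) y<2m)

rotate-< : ∀ m s x → s ≤ m → x < m → rotate m s x < m
rotate-< m s x s≤m x<m = reduce-< m (x + s) (+-mono-<-≤ x<m s≤m)

reduce-spec : ∀ m y z → z < m → y ≡ z ⊎ y ≡ z + m → reduce m y ≡ z
reduce-spec m y z z<m (inj₁ refl) rewrite yes⇒true (y <? m) z<m = refl
reduce-spec m y z z<m (inj₂ refl) rewrite no⇒false (y <? m) (≤⇒≯ (m≤n+m m z)) = m+n∸n≡m z m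

reduce-≡ : ∀ m y z → reduce m y ≡ reduce m z → y ≡ z ⊎ y ≡ z + m ⊎ z ≡ y + m
reduce-≡ m y z eq with y <? m | z <? m
... | yes _  | yes _  = inj₁ eq
... | yes _  | no z≮m = inj₂ (inj₂ (trans (≡-sym (m∸n+n≡m (≮⇒≥ z≮m))) (cong (_+ m) (≡-sym eq))))
... | no y≮m | yes _  = inj₂ (inj₁ (trans (≡-sym (m∸n+n≡m (≮⇒≥ y≮m))) (cong (_+ m) eq)))
... | no y≮m | no z≮m = inj₁ (trans (≡-sym (m∸n+n≡m (≮⇒≥ y≮m))) (trans (cong (_+ m) eq) (m∸n+n≡m (≮⇒≥ z≮m))))

reduce-shift-injective : ∀ m u c c′ → c < m → c′ < m → reduce m (u + c) ≡ reduce m (u + c′) → c ≡ c′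
reduce-shift-injective m u c c′ c<m c′<m eq with reduce-≡ m (u + c) (u + c′) eq
... | inj₁ same          = +-cancelˡ-≡ u c c′ same
... | inj₂ (inj₁ larger) = ⊥-elim (<⇒≱ c<m  (subst (m ≤_) (≡-sym (+-cancelˡ-≡ u c (c′ + m) (trans larger (+-assoc u c′ m)))) (m≤n+m m c′)))
... | inj₂ (inj₂ larger) = ⊥-elim (<⇒≱ c′<m (subst (m ≤_) (≡-sym (+-cancelˡ-≡ u c′ (c + m) (trans larger (+-assoc u c m)))) (m≤n+m m c)))

rotate-inverse : ∀ m s x → s ≤ m → x < m → rotate m (m ∸ s) (rotate m s x) ≡ x
rotate-inverse m s x s≤m x<m with x + s <? m
... | yes _ = reduce-spec m _ x x<m (inj₂ (begin
  x + s + (m ∸ s)   ≡⟨ +-assoc x s (m ∸ s) ⟩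
  x + (s + (m ∸ s)) ≡⟨ cong (x +_) (m+[n∸m]≡n s≤m) ⟩
  x + m             ∎))
  where open ≡-Reasoning
... | no x+s≮m = reduce-spec m _ x x<m (inj₁ (begin
  x + s ∸ m + (m ∸ s)     ≡⟨ ≡-sym (+-∸-assoc (x + s ∸ m) s≤m) ⟩
  x + s ∸ m + m ∸ s       ≡⟨ cong (_∸ s) (m∸n+n≡m (≮⇒≥ x+s≮m)) ⟩
  x + s ∸ s               ≡⟨ m+n∸n≡m x s ⟩
  x                       ∎))
  where open ≡-Reasoning

twice : ℕ → ℕ
twice t = t + t

twice-suc : ∀ t → twice (suc t) ≡ 2 + twice t
twice-suc t = cong suc (+-suc t t)

mate : ℕ → ℕ
mate zero          = 1
mate (suc zero)    = 0
mate (suc (suc u)) = suc (suc (mate u))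

mate-involutive : ∀ u → mate (mate u) ≡ u
mate-involutive zero          = refl
mate-involutive (suc zero)    = refl
mate-involutive (suc (suc u)) = cong (2 +_) (mate-involutive u)

mate-≢ : ∀ u → mate u ≢ u
mate-≢ zero          ()
mate-≢ (suc zero)    ()
mate-≢ (suc (suc u)) eq = mate-≢ u (suc-injective (suc-injective eq))

mate-< : ∀ j u → u < twice j → mate u < twice j
mate-< (suc j) zero          _ rewrite +-suc j j = s≤s (s≤s z≤n)
mate-< (suc j) (suc zero)    _ = s≤s z≤n
mate-< (suc j) (suc (suc u)) u< rewrite +-suc j j = s≤s (s≤s (mate-< j u (s≤s⁻¹ (s≤s⁻¹ u<))))

mate-twice : ∀ t → mate (twice t) ≡ suc (twice t)
mate-twice zero    = refl
mate-twice (suc t) rewrite +-suc t t = cong (2 +_) (mate-twice t)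

mate-suc-twice : ∀ t → mate (suc (twice t)) ≡ twice t
mate-suc-twice zero    = refl
mate-suc-twice (suc t) rewrite +-suc t t = cong (2 +_) (mate-suc-twice t)

data InPair (i u : ℕ) : Set where
  first  : u ≡ twice i       → InPair i u
  second : u ≡ suc (twice i) → InPair i u

data Off (i u : ℕ) : Set where
  before : u < twice i     → Off i u
  after  : 2 + twice i ≤ u → Off i u

pair-of : ∀ j u → u < twice j → ∃ λ t → t < j × InPair t u
pair-of (suc j) zero          _  = 0 , z<s , first refl
pair-of (suc j) (suc zero)    _  = 0 , z<s , second refl
pair-of (suc j) (suc (suc u)) u< with pair-of j u (+-cancelˡ-< 2 u (twice j) (subst (2 + u <_) (twice-suc j) u<))
... | t , t<j , first u≡  = suc t , s≤s t<j , first (trans (cong (2 +_) u≡) (≡-sym (twice-suc t)))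
... | t , t<j , second u≡ = suc t , s≤s t<j , second (trans (cong (2 +_) u≡) (cong suc (≡-sym (twice-suc t))))

pair-< : ∀ {t j} → t < j → suc (twice t) < twice j
pair-< {t} {j} t<j = subst (_≤ twice j) (twice-suc t) (+-mono-≤ t<j t<j)

twice-injective : ∀ i j → twice i ≡ twice j → i ≡ j
twice-injective zero    zero    _ = refl
twice-injective (suc i) (suc j) eq rewrite +-suc i i | +-suc j j =
  cong suc (twice-injective i j (suc-injective (suc-injective eq)))

twice-≢-odd : ∀ i j → twice i ≢ suc (twice j)
twice-≢-odd (suc i) zero    eq rewrite +-suc i i with () ← suc-injective eq
twice-≢-odd (suc i) (suc j) eq rewrite +-suc i i | +-suc j j = twice-≢-odd i j (suc-injective (suc-injective eq))

twice-<-cancel : ∀ i j → twice i < twice j → i < j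
twice-<-cancel i j 2i<2j with i <? j
... | yes i<j = i<j
... | no j≤i = ⊥-elim (<-irrefl refl (<-≤-trans 2i<2j (+-mono-≤ (≮⇒≥ j≤i) (≮⇒≥ j≤i))))

inPair-or-off : ∀ i u → InPair i u ⊎ Off i u
inPair-or-off i u with u <? twice i
... | yes u<2i = inj₂ (before u<2i)
... | no u≮2i with m≤n⇒m<n∨m≡n (≮⇒≥ u≮2i)
...   | inj₂ 2i≡u = inj₁ (first (≡-sym 2i≡u))
...   | inj₁ 2i<u with m≤n⇒m<n∨m≡n 2i<u
...     | inj₂ 2i+1≡u = inj₁ (second (≡-sym 2i+1≡u))
...     | inj₁ 2i+1<u = inj₂ (after 2i+1<u)

off⇒¬inPair : ∀ {i u} → Off i u → ¬ InPair i u
off⇒¬inPair (before u<2i)  (first refl)  = <-irrefl refl u<2i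
off⇒¬inPair (before u<2i)  (second refl) = <-irrefl refl (<-trans u<2i (n<1+n _))
off⇒¬inPair (after 2i+2≤u) (first refl)  = <-irrefl refl (<-trans (n<1+n _) 2i+2≤u)
off⇒¬inPair (after 2i+2≤u) (second refl) = <-irrefl refl 2i+2≤u

inPair? : ∀ i u → Dec (InPair i u)
inPair? i u with inPair-or-off i u
... | inj₁ inPair = yes inPair
... | inj₂ off    = no (off⇒¬inPair off)

inPair-unique : ∀ {i j u} → InPair i u → InPair j u → i ≡ j
inPair-unique {i} {j} (first refl)  (first 2i≡2j)     = twice-injective i j 2i≡2j
inPair-unique {i} {j} (first refl)  (second 2i≡2j+1)  = ⊥-elim (twice-≢-odd i j 2i≡2j+1)
inPair-unique {i} {j} (second refl) (first 2i+1≡2j)   = ⊥-elim (twice-≢-odd j i (≡-sym 2i+1≡2j))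
inPair-unique {i} {j} (second refl) (second 2i+1≡2j+1) = twice-injective i j (suc-injective 2i+1≡2j+1)

inPair-mate : ∀ {i u} → InPair i u → InPair i (mate u)
inPair-mate {i} (first refl)  = second (mate-twice i)
inPair-mate {i} (second refl) = first (mate-suc-twice i)

inPair-< : ∀ {i j u} → InPair i u → i < j → u < twice j
inPair-< (first refl)  i<j = <-trans (n<1+n _) (pair-< i<j)
inPair-< (second refl) i<j = pair-< i<j

-- rank i u is the position of u among the numbers other than 2i and 2i + 1; unrank i inverts it.
rank unrank : ℕ → ℕ → ℕ
rank   i u = if ⌊ u <? twice i ⌋ then u else u ∸ 2
unrank i t = if ⌊ t <? twice i ⌋ then t else 2 + t

rank-before : ∀ i {u} → u < twice i → rank i u ≡ u
rank-before i {u} u<2i rewrite yes⇒true (u <? twice i) u<2i = refl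

rank-after : ∀ i {u} → 2 + twice i ≤ u → rank i u ≡ u ∸ 2
rank-after i {u} 2i+2≤u rewrite no⇒false (u <? twice i) (≤⇒≯ (≤-trans (m≤n+m (twice i) 2) 2i+2≤u)) = refl

after-∸2 : ∀ i {u} → 2 + twice i ≤ u → 2 + (u ∸ 2) ≡ u
after-∸2 i 2i+2≤u = m+[n∸m]≡n (≤-trans (m≤m+n 2 (twice i)) 2i+2≤u)

rank-< : ∀ {i u} M → twice i ≤ M → Off i u → u < 2 + M → rank i u < M
rank-< {i} M 2i≤M (before u<2i)   _  rewrite rank-before i u<2i = <-≤-trans u<2i 2i≤M
rank-< {i} M 2i≤M (after 2i+2≤u) u< rewrite rank-after i 2i+2≤u =
  +-cancelˡ-< 2 _ _ (subst (_< 2 + M) (≡-sym (after-∸2 i 2i+2≤u)) u<)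

unrank-cases : ∀ i t → (t < twice i × unrank i t ≡ t) ⊎ (twice i ≤ t × unrank i t ≡ 2 + t)
unrank-cases i t with t <? twice i
... | yes t<2i = inj₁ (t<2i , refl)
... | no t≮2i  = inj₂ (≮⇒≥ t≮2i , refl)

unrank-off : ∀ i t → Off i (unrank i t)
unrank-off i t with unrank-cases i t
... | inj₁ (t<2i , eq) = before (subst (_< twice i) (≡-sym eq) t<2i)
... | inj₂ (2i≤t , eq) = after (subst (2 + twice i ≤_) (≡-sym eq) (+-monoʳ-≤ 2 2i≤t))

unrank-< : ∀ i {t} M → t < M → unrank i t < 2 + M
unrank-< i {t} M t<M with unrank-cases i t
... | inj₁ (_ , eq) rewrite eq = <-trans t<M (m<n+m M z<s)
... | inj₂ (_ , eq) rewrite eq = +-monoʳ-< 2 t<M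

unrank-rank : ∀ i {u} → Off i u → unrank i (rank i u) ≡ u
unrank-rank i (before u<2i) rewrite rank-before i u<2i with unrank-cases i _
... | inj₁ (_ , eq)    = eq
... | inj₂ (2i≤u , _)  = ⊥-elim (<⇒≱ u<2i 2i≤u)
unrank-rank i {u} (after 2i+2≤u) rewrite rank-after i 2i+2≤u with unrank-cases i (u ∸ 2)
... | inj₁ (u-2<2i , _) = ⊥-elim (<⇒≱ u-2<2i (+-cancelˡ-≤ 2 _ _ (subst (2 + twice i ≤_) (≡-sym (after-∸2 i 2i+2≤u)) 2i+2≤u)))
... | inj₂ (_ , eq)     = trans eq (after-∸2 i 2i+2≤u)

rank-unrank : ∀ i t → rank i (unrank i t) ≡ t
rank-unrank i t with unrank-cases i t
... | inj₁ (t<2i , eq) rewrite eq = rank-before i t<2i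
... | inj₂ (2i≤t , eq) rewrite eq = rank-after i (+-monoʳ-≤ 2 2i≤t)

-- offset i u: how far u moves when pair i is removed and the rest is rotated by 3 + i.
offset : ℕ → ℕ → ℕ
offset i u = if ⌊ u <? twice i ⌋ then 3 + i else 1 + i

offset-before : ∀ i {u} → u < twice i → offset i u ≡ 3 + i
offset-before i {u} u<2i rewrite yes⇒true (u <? twice i) u<2i = refl

offset-after : ∀ i {u} → 2 + twice i ≤ u → offset i u ≡ 1 + i
offset-after i {u} 2i+2≤u rewrite no⇒false (u <? twice i) (≤⇒≯ (≤-trans (m≤n+m (twice i) 2) 2i+2≤u)) = refl

rank-offset : ∀ i {u} → Off i u → rank i u + (3 + i) ≡ u + offset i u
rank-offset i (before u<2i) rewrite rank-before i u<2i | offset-before i u<2i = refl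
rank-offset i {u} (after 2i+2≤u) rewrite rank-after i 2i+2≤u | offset-after i 2i+2≤u = begin
  u ∸ 2 + (2 + (1 + i))  ≡⟨ ≡-sym (+-assoc (u ∸ 2) 2 (1 + i)) ⟩
  u ∸ 2 + 2 + (1 + i)    ≡⟨ cong (_+ (1 + i)) (trans (+-comm (u ∸ 2) 2) (after-∸2 i 2i+2≤u)) ⟩
  u + (1 + i)            ∎
  where open ≡-Reasoning

offset-pos : ∀ i u → 0 < offset i u
offset-pos i u with u <? twice i
... | yes _ = z<s
... | no _  = z<s

offset-≤ : ∀ i u → offset i u ≤ 3 + i
offset-≤ i u with u <? twice i
... | yes _ = ≤-refl
... | no _  = +-monoˡ-≤ i (s≤s z≤n)

-- A point before pair i and after pair j has j < i, so 1 + j cannot be 3 + i.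
crossing : ∀ {i j u} → u < twice i → 2 + twice j ≤ u → 3 + i ≢ 1 + j
crossing {i} {j} u<2i 2j+2≤u eq = <⇒≱ j<i (subst (i ≤_) (suc-injective eq) (m≤n+m i 2))
  where j<i : j < i
        j<i = twice-<-cancel j i (<-trans (<-≤-trans (m<n+m (twice j) {2} z<s) 2j+2≤u) u<2i)

offset-injective : ∀ i j {u} → Off i u → Off j u → offset i u ≡ offset j u → i ≡ j
offset-injective i j (before u<2i) (before u<2j) eq
  rewrite offset-before i u<2i | offset-before j u<2j = +-cancelˡ-≡ 3 i j eq
offset-injective i j (after 2i+2≤u) (after 2j+2≤u) eq
  rewrite offset-after i 2i+2≤u | offset-after j 2j+2≤u = +-cancelˡ-≡ 1 i j eq
offset-injective i j (before u<2i) (after 2j+2≤u) eq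
  rewrite offset-before i u<2i | offset-after j 2j+2≤u = ⊥-elim (crossing u<2i 2j+2≤u eq)
offset-injective i j (after 2i+2≤u) (before u<2j) eq
  rewrite offset-after i 2i+2≤u | offset-before j u<2j = ⊥-elim (crossing u<2j 2i+2≤u (≡-sym eq))

sizeB : ℕ → Bool → ℕ
sizeB K false = twice K
sizeB K true  = suc (twice K)

sizeB-lower : ∀ K e → twice K ≤ sizeB K e
sizeB-lower K false = ≤-refl
sizeB-lower K true  = n≤1+n _

sizeB-upper : ∀ K e → sizeB K e ≤ suc (twice K)
sizeB-upper K false = n≤1+n _
sizeB-upper K true  = ≤-refl

-- The construction for m = sizeB K e with K ≥ 4; the bound on K keeps the rotation
-- amounts 3 + i, i < k, below m. The parity e stays an explicit argument throughout.

module Construction (K : ℕ) (4≤K : 4 ≤ K) where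

  k : ℕ
  k = suc K

  m a n : Bool → ℕ
  m e = sizeB K e
  a e = 2 + m e
  n e = a e + m e

  inner : ℕ → ℕ → Bool
  inner u w = ⌊ u <? twice k ⌋ ∧ ⌊ w ≟ mate u ⌋

  cross : Bool → ℕ → ℕ → Bool
  cross e x y = not (e ∧ ⌊ y ≟ x + a e ⌋)

  -- Adjacency on [0, n): block A = [0, a), block B = [a, a + m); B is independent.
  ADJ : Bool → ℕ → ℕ → Bool
  ADJ e u w = if ⌊ u <? a e ⌋ then (if ⌊ w <? a e ⌋ then inner u w else cross e u w)
              else (if ⌊ w <? a e ⌋ then cross e w u else false)

  ADJ-AA : ∀ e {u w} → u < a e → w < a e → ADJ e u w ≡ inner u w
  ADJ-AA e {u} {w} u<a w<a rewrite yes⇒true (u <? a e) u<a | yes⇒true (w <? a e) w<a = refl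

  ADJ-AB : ∀ e {u w} → u < a e → a e ≤ w → ADJ e u w ≡ cross e u w
  ADJ-AB e {u} {w} u<a a≤w rewrite yes⇒true (u <? a e) u<a | no⇒false (w <? a e) (≤⇒≯ a≤w) = refl

  ADJ-BA : ∀ e {u w} → a e ≤ u → w < a e → ADJ e u w ≡ cross e w u
  ADJ-BA e {u} {w} a≤u w<a rewrite no⇒false (u <? a e) (≤⇒≯ a≤u) | yes⇒true (w <? a e) w<a = refl

  ADJ-BB : ∀ e {u w} → a e ≤ u → a e ≤ w → ADJ e u w ≡ false
  ADJ-BB e {u} {w} a≤u a≤w rewrite no⇒false (u <? a e) (≤⇒≯ a≤u) | no⇒false (w <? a e) (≤⇒≯ a≤w) = refl

  inner-sym : ∀ u w → inner u w ≡ inner w u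
  inner-sym u w with u <? twice k | w ≟ mate u | w <? twice k | u ≟ mate w
  ... | yes _  | yes _  | yes _ | yes _ = refl
  ... | yes _  | no _   | yes _ | no _  = refl
  ... | yes _  | no _   | no _  | _     = refl
  ... | no _   | _      | yes _ | no _  = refl
  ... | no _   | _      | no _  | _     = refl
  ... | yes _  | yes w≡ | yes _ | no u≢ = ⊥-elim (u≢ (trans (≡-sym (mate-involutive u)) (cong mate (≡-sym w≡))))
  ... | yes u< | yes w≡ | no w≮ | _     = ⊥-elim (w≮ (subst (_< twice k) (≡-sym w≡) (mate-< k u u<)))
  ... | yes _  | no w≢  | yes _ | yes u≡ = ⊥-elim (w≢ (trans (≡-sym (mate-involutive w)) (cong mate (≡-sym u≡))))
  ... | no u≮  | _      | yes w< | yes u≡ = ⊥-elim (u≮ (subst (_< twice k) (≡-sym u≡) (mate-< k w w<)))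

  ADJ-sym : ∀ e u w → ADJ e u w ≡ ADJ e w u
  ADJ-sym e u w with u <? a e | w <? a e
  ... | yes _ | yes _ = inner-sym u w
  ... | yes _ | no _  = refl
  ... | no _  | yes _ = refl
  ... | no _  | no _  = refl

  ADJ-irrefl : ∀ e u → ADJ e u u ≡ false
  ADJ-irrefl e u with u <? a e
  ... | no _ = refl
  ... | yes _ with u <? twice k | u ≟ mate u
  ...   | yes _ | yes u≡ = ⊥-elim (mate-≢ u (≡-sym u≡))
  ...   | yes _ | no _   = refl
  ...   | no _  | _      = refl

  G : ∀ e → Graph (n e)
  G e = record { adj    = λ u w → ADJ e (toℕ u) (toℕ w)
               ; sym    = λ u w → ADJ-sym e (toℕ u) (toℕ w)
               ; irrefl = λ u → ADJ-irrefl e (toℕ u) }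

  -- The pairs fit into A (they cover A when m is even, and all but its last vertex when m is odd).
  2k≤a : ∀ e → twice k ≤ a e
  2k≤a e = ≤-trans (≤-reflexive (twice-suc K)) (s≤s (s≤s (sizeB-lower K e)))

  m<a : ∀ e → m e < a e
  m<a e = s≤s (n≤1+n (m e))

  ∸-<-B : ∀ e y → a e ≤ y → y < n e → y ∸ a e < m e
  ∸-<-B e y a≤y y<n = subst (y ∸ a e <_) (m+n∸m≡n (a e) (m e)) (∸-monoˡ-< y<n a≤y)

  degree-split : ∀ e (v : Fin (n e)) →
    degree (G e) v ≡ count (ADJ e (toℕ v)) 0 (a e) + count (ADJ e (toℕ v)) (a e) (m e)
  degree-split e v = trans (degreeOf-count (ADJ e) v) (count-++ (ADJ e (toℕ v)) 0 (a e) (m e))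

  paired-degree : ∀ e x → x < twice k → x < a e → count (ADJ e x) 0 (a e) ≡ 1
  paired-degree e x x<2k x<a = begin
    count (ADJ e x) 0 (a e)                ≡⟨ count-cong 0 (a e) (λ w _ w<a → ADJ-AA e x<a w<a) ⟩
    count (inner x) 0 (a e)                ≡⟨ count-cong 0 (a e) (λ w _ _ → cong (_∧ ⌊ w ≟ mate x ⌋) (yes⇒true (x <? twice k) x<2k)) ⟩
    count (λ w → ⌊ w ≟ mate x ⌋) 0 (a e)   ≡⟨ count-point (mate x) 0 (a e) z≤n (<-≤-trans (mate-< k x x<2k) (2k≤a e)) ⟩
    1                                      ∎
    where open ≡-Reasoning

  unpaired-degree : ∀ e x → twice k ≤ x → x < a e → count (ADJ e x) 0 (a e) ≡ 0
  unpaired-degree e x 2k≤x x<a = count-none 0 (a e) (λ w _ w<a →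
    trans (ADJ-AA e x<a w<a) (cong (_∧ ⌊ w ≟ mate x ⌋) (no⇒false (x <? twice k) (≤⇒≯ 2k≤x))))

  A-to-B-full : ∀ e x → x < a e → e ≡ false ⊎ m e ≤ x → count (ADJ e x) (a e) (m e) ≡ m e
  A-to-B-full e x x<a unremoved = count-all (a e) (m e) (λ w a≤w w< → trans (ADJ-AB e x<a a≤w) (present unremoved w w<))
    where
    present : e ≡ false ⊎ m e ≤ x → ∀ w → w < a e + m e → cross e x w ≡ true
    present (inj₁ refl) w _  = refl
    present (inj₂ m≤x)  w w< = cong not (trans (cong (e ∧_) (no⇒false (w ≟ x + a e) w≢)) (∧-zeroʳ e))
      where w≢ : w ≢ x + a e
            w≢ w≡ = <-irrefl refl (<-≤-trans (subst (_< a e + m e) w≡ w<) (subst (_≤ x + a e) (+-comm (m e) (a e)) (+-monoˡ-≤ (a e) m≤x)))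

  A-to-B-but-one : ∀ x → x < m true → count (ADJ true x) (a true) (m true) + 1 ≡ m true
  A-to-B-but-one x x<m = trans
    (cong (_+ 1) (count-cong (a true) (m true) (λ w a≤w _ → ADJ-AB true (<-trans x<m (m<a true)) a≤w)))
    (count-all-but (x + a true) (a true) (m true) (m≤n+m _ x) (subst (x + a true <_) (+-comm (m true) (a true)) (+-monoˡ-< (a true) x<m)))

  B-to-A-full : ∀ y → a false ≤ y → count (ADJ false y) 0 (a false) ≡ a false
  B-to-A-full y a≤y = count-all 0 (a false) (λ w _ w<a → ADJ-BA false a≤y w<a)

  B-to-A-but-one : ∀ y → a true ≤ y → y < n true → count (ADJ true y) 0 (a true) + 1 ≡ a true
  B-to-A-but-one y a≤y y<n = trans
    (cong (_+ 1) (count-cong 0 (a true) (λ w _ w<a → trans (ADJ-BA true a≤y w<a) (cong not (flipped w)))))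
    (count-all-but (y ∸ a true) 0 (a true) z≤n (<-trans (∸-<-B true y a≤y y<n) (m<a true)))
    where
    flipped : ∀ w → ⌊ y ≟ w + a true ⌋ ≡ ⌊ w ≟ y ∸ a true ⌋
    flipped w with y ≟ w + a true | w ≟ y ∸ a true
    ... | yes _  | yes _  = refl
    ... | no _   | no _   = refl
    ... | yes y≡ | no w≢  = ⊥-elim (w≢ (≡-sym (trans (cong (_∸ a true) y≡) (m+n∸n≡m w (a true)))))
    ... | no y≢  | yes w≡ = ⊥-elim (y≢ (≡-sym (trans (cong (_+ a true) w≡) (m∸n+n≡m a≤y))))

  B-to-B : ∀ e y → a e ≤ y → count (ADJ e y) (a e) (m e) ≡ 0
  B-to-B e y a≤y = count-none (a e) (m e) (λ w a≤w _ → ADJ-BB e a≤y a≤w)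

  DegreeOK : ℕ → Set
  DegreeOK d = (d ≡ suc (twice K)) ⊎ (d ≡ 2 + twice K)

  degree-A : ∀ e x → x < a e → DegreeOK (count (ADJ e x) 0 (a e) + count (ADJ e x) (a e) (m e))
  degree-A false x x<a
    rewrite paired-degree false x (subst (x <_) (≡-sym (twice-suc K)) x<a) x<a | A-to-B-full false x x<a (inj₁ refl) = inj₁ refl
  degree-A true x x<a with x <? m true
  ... | yes x<m rewrite paired-degree true x (<-≤-trans x<m (≤-trans (n≤1+n _) (≤-reflexive (≡-sym (twice-suc K))))) x<a =
        inj₁ (trans (+-comm 1 _) (A-to-B-but-one x x<m))
  ... | no x≮m with m≤n⇒m<n∨m≡n (≮⇒≥ x≮m)
  ...   | inj₂ refl rewrite paired-degree true x (subst (x <_) (≡-sym (twice-suc K)) (n<1+n x)) x<a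
                          | A-to-B-full true x x<a (inj₂ ≤-refl) = inj₂ refl
  ...   | inj₁ m<x with ≤-antisym (s≤s⁻¹ x<a) m<x
  ...     | refl rewrite unpaired-degree true x (≤-reflexive (twice-suc K)) x<a
                       | A-to-B-full true x x<a (inj₂ (n≤1+n _)) = inj₁ refl

  degree-B : ∀ e y → a e ≤ y → y < n e → DegreeOK (count (ADJ e y) 0 (a e) + count (ADJ e y) (a e) (m e))
  degree-B false y a≤y _ rewrite B-to-A-full y a≤y | B-to-B false y a≤y = inj₂ (+-identityʳ _)
  degree-B true y a≤y y<n rewrite B-to-B true y a≤y =
    inj₂ (trans (+-identityʳ _) (suc-injective (trans (+-comm 1 _) (B-to-A-but-one y a≤y y<n))))

  degrees : ∀ e (v : Fin (n e)) → DegreeOK (degree (G e) v)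
  degrees e v = subst DegreeOK (≡-sym (degree-split e v)) (byBlock (toℕ v <? a e))
    where
    byBlock : Dec (toℕ v < a e) → DegreeOK (count (ADJ e (toℕ v)) 0 (a e) + count (ADJ e (toℕ v)) (a e) (m e))
    byBlock (yes v<a) = degree-A e (toℕ v) v<a
    byBlock (no v≮a)  = degree-B e (toℕ v) (≮⇒≥ v≮a) (toℕ<n v)

  inside-A-is-pair : ∀ e {x y} → x < a e → y < a e → T (ADJ e x y) → x < twice k × y ≡ mate x
  inside-A-is-pair e {x} {y} x<a y<a xy
    with Equivalence.to (T-∧ {⌊ x <? twice k ⌋} {⌊ y ≟ mate x ⌋}) (subst T (ADJ-AA e x<a y<a) xy)
  ... | x<2k , y≡ = toWitness x<2k , toWitness y≡

  2k≤n : ∀ e → twice k ≤ n e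
  2k≤n e = ≤-trans (2k≤a e) (m≤m+n (a e) (m e))

  pairEnd<n : ∀ e (t : Fin k) → suc (twice (toℕ t)) < n e
  pairEnd<n e t = <-≤-trans (pair-< (toℕ<n t)) (2k≤n e)

  pairStart pairEnd : ∀ e → Fin k → Fin (n e)
  pairStart e t = fromℕ< (<-trans (n<1+n _) (pairEnd<n e t))
  pairEnd   e t = fromℕ< (pairEnd<n e t)

  pairStart-toℕ : ∀ e t → toℕ (pairStart e t) ≡ twice (toℕ t)
  pairStart-toℕ e t = toℕ-fromℕ< (<-trans (n<1+n _) (pairEnd<n e t))

  pairEnd-toℕ : ∀ e t → toℕ (pairEnd e t) ≡ suc (twice (toℕ t))
  pairEnd-toℕ e t = toℕ-fromℕ< (pairEnd<n e t)

  pairStart-≡ : ∀ e {x : Fin (n e)} {t} (t<k : t < k) → toℕ x ≡ twice t → x ≡ pairStart e (fromℕ< t<k)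
  pairStart-≡ e t<k x≡ = toℕ-injective (trans x≡ (≡-sym (trans (pairStart-toℕ e (fromℕ< t<k)) (cong twice (toℕ-fromℕ< t<k)))))

  pairEnd-≡ : ∀ e {x : Fin (n e)} {t} (t<k : t < k) → toℕ x ≡ suc (twice t) → x ≡ pairEnd e (fromℕ< t<k)
  pairEnd-≡ e t<k x≡ = toℕ-injective (trans x≡ (≡-sym (trans (pairEnd-toℕ e (fromℕ< t<k)) (cong ((1 +_) ∘ twice) (toℕ-fromℕ< t<k)))))

  -- Since |A| > |B| and B is independent, every perfect matching uses one of the k pairs.
  matching-uses-a-pair : ∀ e (M : PerfectMatching (G e)) → ∃ λ t → T (medge M (pairStart e t) (pairEnd e t))
  matching-uses-a-pair e M with matching-inside-first-block M (m<a e)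
  ... | u , w , u<a , w<a , uw with inside-A-is-pair e u<a w<a (msub M u w uw)
  ...   | u<2k , w≡ with pair-of k (toℕ u) u<2k
  ...     | t , t<k , first u≡ =
            fromℕ< t<k , subst₂ (λ x y → T (medge M x y))
                           (pairStart-≡ e t<k u≡) (pairEnd-≡ e t<k (trans w≡ (trans (cong mate u≡) (mate-twice t)))) uw
  ...     | t , t<k , second u≡ =
            fromℕ< t<k , subst₂ (λ x y → T (medge M x y))
                           (pairStart-≡ e t<k (trans w≡ (trans (cong mate u≡) (mate-suc-twice t)))) (pairEnd-≡ e t<k u≡)
                           (subst T (msym M u w) uw)

  at-most-k : ∀ e j → DisjointPMFamily (G e) j → j ≤ k
  at-most-k e = disjoint-family-bound (pairStart e) (pairEnd e) (matching-uses-a-pair e)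

  3+i<m : ∀ e {i} → i < k → 3 + i < m e
  3+i<m e {i} i<k = ≤-trans (+-monoʳ-≤ 4 (s≤s⁻¹ i<k)) (≤-trans (+-monoˡ-≤ K 4≤K) (sizeB-lower K e))

  2i≤m : ∀ e {i} → i < k → twice i ≤ m e
  2i≤m e {i} i<k = ≤-trans (+-mono-≤ (s≤s⁻¹ i<k) (s≤s⁻¹ i<k)) (sizeB-lower K e)

  -- the index in B of the partner of a vertex of A off pair i ...
  toB : Bool → ℕ → ℕ → ℕ
  toB e i u = rotate (m e) (3 + i) (rank i u)

  -- ... and the partner in A of the vertex a + j of B
  fromB : Bool → ℕ → ℕ → ℕ
  fromB e i j = unrank i (rotate (m e) (m e ∸ (3 + i)) j)

  toB-< : ∀ e {i u} → i < k → Off i u → u < a e → toB e i u < m e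
  toB-< e {i} i<k off u<a = rotate-< (m e) (3 + i) _ (<⇒≤ (3+i<m e i<k)) (rank-< (m e) (2i≤m e i<k) off u<a)

  fromB-< : ∀ e {i j} → i < k → j < m e → fromB e i j < a e
  fromB-< e {i} i<k j<m = unrank-< i (m e) (rotate-< (m e) _ _ (m∸n≤m (m e) (3 + i)) j<m)

  fromB-toB : ∀ e {i u} → i < k → Off i u → u < a e → fromB e i (toB e i u) ≡ u
  fromB-toB e {i} {u} i<k off u<a = trans
    (cong (unrank i) (rotate-inverse (m e) (3 + i) (rank i u) (<⇒≤ (3+i<m e i<k)) (rank-< (m e) (2i≤m e i<k) off u<a)))
    (unrank-rank i off)

  toB-fromB : ∀ e {i j} → i < k → j < m e → toB e i (fromB e i j) ≡ j
  toB-fromB e {i} {j} i<k j<m = begin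
    rotate (m e) (3 + i) (rank i (unrank i t))       ≡⟨ cong (rotate (m e) (3 + i)) (rank-unrank i t) ⟩
    rotate (m e) (3 + i) t                           ≡⟨ cong (λ s → rotate (m e) s t) (≡-sym (m∸[m∸n]≡n 3+i≤m)) ⟩
    rotate (m e) (m e ∸ (m e ∸ (3 + i))) t           ≡⟨ rotate-inverse (m e) (m e ∸ (3 + i)) j (m∸n≤m (m e) (3 + i)) j<m ⟩
    j                                                ∎
    where open ≡-Reasoning
          t = rotate (m e) (m e ∸ (3 + i)) j
          3+i≤m = <⇒≤ (3+i<m e i<k)

  -- toB moves u by a nonzero offset smaller than m.
  toB-≢ : ∀ e {i u} → i < k → Off i u → u < a e → toB e i u ≢ u
  toB-≢ e {i} {u} i<k off u<a toB≡u with u <? m e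
  ... | no u≮m  = u≮m (subst (_< m e) toB≡u (toB-< e i<k off u<a))
  ... | yes u<m = <-irrefl (≡-sym offset≡0) (offset-pos i u)
    where
    offset≡0 : offset i u ≡ 0
    offset≡0 = reduce-shift-injective (m e) u (offset i u) 0
      (≤-<-trans (offset-≤ i u) (3+i<m e i<k)) (≤-<-trans z≤n u<m)
      (begin
        reduce (m e) (u + offset i u)        ≡⟨ cong (reduce (m e)) (≡-sym (rank-offset i off)) ⟩
        toB e i u                            ≡⟨ toB≡u ⟩
        u                                    ≡⟨ ≡-sym (reduce-spec (m e) (u + 0) u u<m (inj₁ (+-identityʳ u))) ⟩
        reduce (m e) (u + 0)                 ∎)
      where open ≡-Reasoning

  -- The i-th matching as an involution of [0, n): pair i is matched inside A, every other
  -- vertex u of A is matched to a + toB e i u, and B is matched back by fromB.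
  π : Bool → ℕ → ℕ → ℕ
  π e i u = if ⌊ u <? a e ⌋
            then (if ⌊ inPair? i u ⌋ then mate u else a e + toB e i u)
            else fromB e i (u ∸ a e)

  inPair-<a : ∀ e {i u} → i < k → InPair i u → u < a e
  inPair-<a e i<k inPair = <-≤-trans (inPair-< inPair i<k) (2k≤a e)

  π-pair : ∀ e {i u} → i < k → InPair i u → π e i u ≡ mate u
  π-pair e {i} {u} i<k inPair rewrite yes⇒true (u <? a e) (inPair-<a e i<k inPair) | yes⇒true (inPair? i u) inPair = refl

  π-off : ∀ e {i u} → Off i u → u < a e → π e i u ≡ a e + toB e i u
  π-off e {i} {u} off u<a rewrite yes⇒true (u <? a e) u<a | no⇒false (inPair? i u) (off⇒¬inPair off) = refl

  π-B : ∀ e {i u} → a e ≤ u → π e i u ≡ fromB e i (u ∸ a e)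
  π-B e {i} {u} a≤u rewrite no⇒false (u <? a e) (≤⇒≯ a≤u) = refl

  data Kind (e : Bool) (i u : ℕ) : Set where
    paired  : InPair i u → Kind e i u
    offA    : Off i u → u < a e → Kind e i u
    inB     : a e ≤ u → u ∸ a e < m e → Kind e i u

  kind : ∀ e i {u} → u < n e → Kind e i u
  kind e i {u} u<n with u <? a e | inPair-or-off i u
  ... | yes _   | inj₁ inPair = paired inPair
  ... | yes u<a | inj₂ off    = offA off u<a
  ... | no u≮a  | _           = inB (≮⇒≥ u≮a) (∸-<-B e u (≮⇒≥ u≮a) u<n)

  π-< : ∀ e {i u} → i < k → u < n e → π e i u < n e
  π-< e {i} {u} i<k u<n with kind e i u<n
  ... | paired inPair rewrite π-pair e i<k inPair =
        <-≤-trans (inPair-<a e i<k (inPair-mate inPair)) (m≤m+n (a e) (m e))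
  ... | offA off u<a  rewrite π-off e off u<a = +-monoʳ-< (a e) (toB-< e i<k off u<a)
  ... | inB a≤u j<m   rewrite π-B e {i} a≤u = <-≤-trans (fromB-< e i<k j<m) (m≤m+n (a e) (m e))

  π-involutive : ∀ e {i u} → i < k → u < n e → π e i (π e i u) ≡ u
  π-involutive e {i} {u} i<k u<n with kind e i u<n
  ... | paired inPair rewrite π-pair e i<k inPair | π-pair e i<k (inPair-mate inPair) = mate-involutive u
  ... | offA off u<a  rewrite π-off e off u<a | π-B e {i} (m≤m+n (a e) (toB e i u)) | m+n∸m≡n (a e) (toB e i u) =
        fromB-toB e i<k off u<a
  ... | inB a≤u j<m   rewrite π-B e {i} a≤u
                            | π-off e (unrank-off i _) (fromB-< e i<k j<m)
                            | toB-fromB e i<k j<m = m+[n∸m]≡n a≤u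

  pair-edge : ∀ e {u} → u < twice k → T (ADJ e u (mate u))
  pair-edge e {u} u<2k = subst T (≡-sym (ADJ-AA e u<a (<-≤-trans (mate-< k u u<2k) (2k≤a e))))
                                 (Equivalence.from (T-∧ {⌊ u <? twice k ⌋} {⌊ mate u ≟ mate u ⌋}) (fromWitness u<2k , fromWitness refl))
    where u<a = <-≤-trans u<2k (2k≤a e)

  cross-edge : ∀ e {x y} → x < a e → a e ≤ y → y ≢ x + a e → T (ADJ e x y)
  cross-edge e {x} {y} x<a a≤y y≢ =
    subst T (≡-sym (trans (ADJ-AB e x<a a≤y) (cong not (trans (cong (e ∧_) (no⇒false (y ≟ x + a e) y≢)) (∧-zeroʳ e))))) tt

  off-adjacent : ∀ e {i u} → i < k → Off i u → u < a e → T (ADJ e u (π e i u))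
  off-adjacent e {i} {u} i<k off u<a rewrite π-off e off u<a =
    cross-edge e u<a (m≤m+n (a e) _) (λ eq → toB-≢ e i<k off u<a (+-cancelˡ-≡ (a e) _ _ (trans eq (+-comm u (a e)))))

  π-adjacent : ∀ e {i u} → i < k → u < n e → T (ADJ e u (π e i u))
  π-adjacent e {i} {u} i<k u<n with kind e i u<n
  ... | paired inPair rewrite π-pair e i<k inPair = pair-edge e (inPair-< inPair i<k)
  ... | offA off u<a  = off-adjacent e i<k off u<a
  ... | inB a≤u j<m   = subst T (ADJ-sym e (π e i u) u) partner-sees-u
    where
    v<a : π e i u < a e
    v<a = subst (_< a e) (≡-sym (π-B e a≤u)) (fromB-< e i<k j<m)
    v-off : Off i (π e i u)
    v-off = subst (Off i) (≡-sym (π-B e a≤u)) (unrank-off i _)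
    partner-sees-u : T (ADJ e (π e i u) u)
    partner-sees-u = subst (λ w → T (ADJ e (π e i u) w)) (π-involutive e i<k u<n) (off-adjacent e i<k v-off v<a)

  toB-offset : ∀ e {i u} → Off i u → toB e i u ≡ reduce (m e) (u + offset i u)
  toB-offset e {i} off = cong (reduce (m e)) (rank-offset i off)

  π-distinct-A : ∀ e {i j u} → i < k → j < k → u < a e → π e i u ≡ π e j u → i ≡ j
  π-distinct-A e {i} {j} {u} i<k j<k u<a eq = byPlace (inPair-or-off i u) (inPair-or-off j u)
    where
    inA-vs-inB : ∀ {i′ j′} → i′ < k → InPair i′ u → Off j′ u → π e i′ u ≢ π e j′ u
    inA-vs-inB {i′} {j′} i′<k inPair off eq′ = <⇒≱ (inPair-<a e i′<k (inPair-mate inPair)) (begin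
      a e                  ≤⟨ m≤m+n (a e) (toB e j′ u) ⟩
      a e + toB e j′ u     ≡⟨ ≡-sym (π-off e off u<a) ⟩
      π e j′ u             ≡⟨ ≡-sym eq′ ⟩
      π e i′ u             ≡⟨ π-pair e i′<k inPair ⟩
      mate u               ∎)
      where open ≤-Reasoning
    byPlace : InPair i u ⊎ Off i u → InPair j u ⊎ Off j u → i ≡ j
    byPlace (inj₁ inPairᵢ) (inj₁ inPairⱼ) = inPair-unique inPairᵢ inPairⱼ
    byPlace (inj₁ inPairᵢ) (inj₂ offⱼ)    = ⊥-elim (inA-vs-inB i<k inPairᵢ offⱼ eq)
    byPlace (inj₂ offᵢ)    (inj₁ inPairⱼ) = ⊥-elim (inA-vs-inB j<k inPairⱼ offᵢ (≡-sym eq))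
    byPlace (inj₂ offᵢ)    (inj₂ offⱼ)    = offset-injective i j offᵢ offⱼ
      (reduce-shift-injective (m e) u (offset i u) (offset j u)
        (≤-<-trans (offset-≤ i u) (3+i<m e i<k)) (≤-<-trans (offset-≤ j u) (3+i<m e j<k))
        (begin
          reduce (m e) (u + offset i u)   ≡⟨ ≡-sym (toB-offset e offᵢ) ⟩
          toB e i u                       ≡⟨ +-cancelˡ-≡ (a e) _ _ (trans (≡-sym (π-off e offᵢ u<a)) (trans eq (π-off e offⱼ u<a))) ⟩
          toB e j u                       ≡⟨ toB-offset e offⱼ ⟩
          reduce (m e) (u + offset j u)   ∎))
      where open ≡-Reasoning

  -- ... hence any vertex, since a vertex of B is the partner of a vertex of A.
  π-distinct : ∀ e {i j u} → i < k → j < k → u < n e → π e i u ≡ π e j u → i ≡ j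
  π-distinct e {i} {j} {u} i<k j<k u<n eq = byBlock (u <? a e)
    where
    byBlock : Dec (u < a e) → i ≡ j
    byBlock (yes u<a) = π-distinct-A e i<k j<k u<a eq
    byBlock (no u≮a)  = π-distinct-A e i<k j<k v<a (begin
        π e i (π e i u)   ≡⟨ π-involutive e i<k u<n ⟩
        u                 ≡⟨ ≡-sym (π-involutive e j<k u<n) ⟩
        π e j (π e j u)   ≡⟨ cong (π e j) (≡-sym eq) ⟩
        π e j (π e i u)   ∎)
      where open ≡-Reasoning
            v<a : π e i u < a e
            v<a = subst (_< a e) (≡-sym (π-B e (≮⇒≥ u≮a))) (fromB-< e i<k (∸-<-B e u (≮⇒≥ u≮a) u<n))

  matchingInvolution : ∀ e → Fin k → MatchingInvolution (G e)
  matchingInvolution e i = record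
    { p          = π e (toℕ i)
    ; p-<        = λ u → π-< e (toℕ<n i)
    ; involutive = λ u → π-involutive e (toℕ<n i)
    ; adjacent   = λ u w w≡ → subst (T ∘ ADJ e (toℕ u)) (≡-sym w≡) (π-adjacent e (toℕ<n i) (toℕ<n u))
    }

  at-least-k : ∀ e → DisjointPMFamily (G e) k
  at-least-k e = involutionMatching ∘ matchingInvolution e , λ i j i≢j →
    involutionMatchings-disjoint (matchingInvolution e i) (matchingInvolution e j)
      (λ u u<n πᵢ≡πⱼ → i≢j (toℕ-injective (π-distinct e (toℕ<n i) (toℕ<n j) u<n πᵢ≡πⱼ)))

order : ℕ → Bool → ℕ
order K e = 2 + sizeB K e + sizeB K e

sizeB-onto : ∀ r → ∃₂ λ K e → sizeB K e ≡ r
sizeB-onto zero          = 0 , false , refl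
sizeB-onto (suc zero)    = 0 , true , refl
sizeB-onto (suc (suc r)) with sizeB-onto r
... | K , false , refl = suc K , false , cong suc (+-suc K K)
... | K , true  , refl = suc K , true  , cong (2 +_) (+-suc K K)

even-is-order : ∀ n → 2 ∣ n → 0 < n → ∃₂ λ K e → n ≡ order K e
even-is-order n (divides zero    n≡0) 0<n = ⊥-elim (<-irrefl (≡-sym n≡0) 0<n)
even-is-order n (divides (suc r) n≡)  _   with sizeB-onto r
... | K , e , refl = K , e , trans n≡ (cong (2 +_) (trans (*-comm (sizeB K e) 2) (cong (sizeB K e +_) (+-identityʳ _))))

-- Orders at least 34 need K ≥ 4 (already K ≤ 3 gives order at most 16).
order≥34⇒4≤K : ∀ K e → 34 ≤ order K e → 4 ≤ K
order≥34⇒4≤K K e 34≤order with 4 ≤? K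
... | yes 4≤K = 4≤K
... | no K≱4  = ⊥-elim (<⇒≱ (toWitness {a? = 16 <? 34} tt) (≤-trans 34≤order (+-mono-≤ (+-monoʳ-≤ 2 size≤7) size≤7)))
  where size≤7 : sizeB K e ≤ 7
        size≤7 = ≤-trans (sizeB-upper K e) (s≤s (+-mono-≤ K≤3 K≤3))
          where K≤3 = s≤s⁻¹ (≰⇒> K≱4)

ceil-order : ∀ K e → ⌈ order K e /4⌉ ≡ suc K
ceil-order K e = begin
  (order K e + 3) / 4          ≡⟨ cong (_/ 4) (order+3 e) ⟩
  (suc K * 4 + rest e) / 4     ≡⟨ +-distrib-/-∣ˡ (rest e) (divides (suc K) refl) ⟩
  suc K * 4 / 4 + rest e / 4   ≡⟨ cong₂ _+_ (m*n/n≡m (suc K) 4) (m<n⇒m/n≡0 (rest<4 e)) ⟩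
  suc K + 0                    ≡⟨ +-identityʳ (suc K) ⟩
  suc K                        ∎
  where
  open ≡-Reasoning
  rest : Bool → ℕ
  rest false = 1
  rest true  = 3
  rest<4 : ∀ e → rest e < 4
  rest<4 false = s≤s (s≤s z≤n)
  rest<4 true  = s≤s (s≤s (s≤s (s≤s z≤n)))
  order+3 : ∀ e → order K e + 3 ≡ suc K * 4 + rest e
  order+3 false = even K
    where even : ∀ K → 2 + (K + K) + (K + K) + 3 ≡ suc K * 4 + 1
          even = solve-∀
  order+3 true  = odd K
    where odd : ∀ K → 2 + suc (K + K) + suc (K + K) + 3 ≡ suc K * 4 + 3
          odd = solve-∀

2k∸1 : ∀ K → 2 * suc K ∸ 1 ≡ suc (twice K)
2k∸1 K = trans (cong (λ x → K + suc x) (+-identityʳ K)) (+-suc K K)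

degree-form : ∀ K {d} → (d ≡ suc (twice K)) ⊎ (d ≡ 2 + twice K) →
  (d ≡ 2 * suc K ∸ 1) ⊎ (d ≡ (2 * suc K ∸ 1) + 1)
degree-form K (inj₁ d≡) = inj₁ (trans d≡ (≡-sym (2k∸1 K)))
degree-form K (inj₂ d≡) = inj₂ (trans d≡ (trans (+-comm 1 (suc (twice K))) (cong (_+ 1) (≡-sym (2k∸1 K)))))

theorem3p4 : (n : ℕ) → 34 ≤ n → 2 ∣ n →
    Σ (Graph n) λ G →
      (∀ v → (degree G v ≡ 2 * ⌈ n /4⌉ ∸ 1) ⊎ (degree G v ≡ (2 * ⌈ n /4⌉ ∸ 1) + 1))
      × MaxDisjointPM G ⌈ n /4⌉
theorem3p4 n 34≤n 2∣n with even-is-order n 2∣n (≤-trans (s≤s z≤n) 34≤n)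
... | K , e , refl rewrite ceil-order K e =
  G e , (λ v → degree-form K (degrees e v)) , at-least-k e , at-most-k e
  where open Construction K (order≥34⇒4≤K K e 34≤n)
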